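{- Let $n\ge1$, $d_0,\ldots,d_n$ positive integers, $j\in\{1,\ldots,n\}$, $B_j=[d_0]\times\cdots\times[d_{j-1}]$, and for $c\in B_j$ let $r_c$ be the unique common solution of $\ell_{j,e_0+c_0}=\cdots=\ell_{j,e_{j-1}+c_{j-1}}=0$. For $c\in B_j$ and $i\in\{0,\dots,j-1\}$ define $\kappa_{c,i}\coloneqq\big(g_{i,j}/\ell_{j,e_i+c_i}\big)(r_c)$. Then the Jacobian matrix $\mathcal{J}_c$ of $(g_{0,j},\dots,g_{j-1,j})$ with respect to $(x_0,\dots,x_{j-1})$ at $r_c$ is invertible and factors as \[\mathcal{J}_c=\mathrm{diag}(\kappa_{c,0},\ldots,\kappa_{c,j-1})\cdot\mathrm{Vand}(e_0+c_0,\ldots,e_{j-1}+c_{j-1}).\]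
   Context: $L_{j,m}(x)\coloneqq x_0+mx_1+\cdots+m^jx_j$, $\ell_{j,m}\coloneqq L_{j,m}|_{x_j=1}$; $e_0=0$, $e_i=d_0+\cdots+d_{i-1}$; $A_i=\{e_i+1,\dots,e_i+d_i\}$; $G_{i,j}=\prod_{k\in A_i}L_{j,k}$; $g_{i,j}=G_{i,j}|_{x_j=1}$. $\mathrm{Vand}(z_0,\dots,z_{j-1})$ is the $j\times j$ matrix whose $(i,a)$ entry is $z_i^{a}$ (rows $i=0..j-1$, columns $a=0..j-1$). $[d]=\{1,\dots,d\}$. -}

module Defs where

open import Data.Nat as ℕ using (ℕ; zero; suc)
open import Data.Fin using (Fin; zero; suc; toℕ)
open import Data.Maybe using (Maybe; just; nothing)
import Data.Maybe as Maybe
open import Data.List using (List; []; _∷_; foldr; map; upTo; allFin; filterᵇ)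
open import Data.Bool using (not)
open import Data.Rational using (ℚ; 0ℚ; 1ℚ; _+_; _*_; _/_)
open import Data.Integer using (+_)
open import Relation.Binary.PropositionalEquality using (_≡_)
open import Relation.Nullary using (yes; no)
open import Data.Product using (Σ; _×_)

⟦_⟧ℕ : ℕ → ℚ
⟦ m ⟧ℕ = + m / 1

data Poly (v : ℕ) : Set where
  con  : ℚ → Poly v
  var  : Fin v → Poly v
  _⊕_  : Poly v → Poly v → Poly v
  _⊗_  : Poly v → Poly v → Poly v

infixl 6 _⊕_
infixl 7 _⊗_

eval : ∀ {v} → (Fin v → ℚ) → Poly v → ℚ
eval r (con q)   = q
eval r (var a)   = r a
eval r (p ⊕ q)   = eval r p + eval r q
eval r (p ⊗ q)   = eval r p * eval r q

∂ : ∀ {v} → Fin v → Poly v → Poly v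
∂ a (con q)   = con 0ℚ
∂ a (var b)   with toℕ a ℕ.≟ toℕ b
... | yes _ = con 1ℚ
... | no _  = con 0ℚ
∂ a (p ⊕ q)   = ∂ a p ⊕ ∂ a q
∂ a (p ⊗ q)   = ∂ a p ⊗ q ⊕ p ⊗ ∂ a q

subst : ∀ {v w} → (Fin v → Poly w) → Poly v → Poly w
subst σ (con q) = con q
subst σ (var a) = σ a
subst σ (p ⊕ q) = subst σ p ⊕ subst σ q
subst σ (p ⊗ q) = subst σ p ⊗ subst σ q

sumP : ∀ {v} → List (Poly v) → Poly v
sumP = foldr _⊕_ (con 0ℚ)

prodP : ∀ {v} → List (Poly v) → Poly v
prodP = foldr _⊗_ (con 1ℚ)

splitLast : ∀ {j} → Fin (suc j) → Maybe (Fin j)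
splitLast {zero}  zero    = nothing
splitLast {suc j} zero    = just zero
splitLast {suc j} (suc a) = Maybe.map suc (splitLast a)

setLast1 : ∀ {j} → Poly (suc j) → Poly j
setLast1 {j} = subst σ
  where
  σ : Fin (suc j) → Poly j
  σ a with splitLast a
  ... | just b  = var b
  ... | nothing = con 1ℚ

L : (j m : ℕ) → Poly (suc j)
L j m = sumP (map (λ a → con ⟦ m ℕ.^ toℕ a ⟧ℕ ⊗ var a) (allFin (suc j)))

ℓ : (j m : ℕ) → Poly j
ℓ j m = setLast1 (L j m)

e : (ℕ → ℕ) → ℕ → ℕ
e d zero    = 0
e d (suc i) = e d i ℕ.+ d i

A : (ℕ → ℕ) → ℕ → List ℕ
A d i = map (λ t → e d i ℕ.+ suc t) (upTo (d i))

G : (ℕ → ℕ) → ℕ → (j : ℕ) → Poly (suc j)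
G d i j = prodP (map (L j) (A d i))

g : (ℕ → ℕ) → ℕ → (j : ℕ) → Poly j
g d i j = setLast1 (G d i j)

-- the quotient polynomial g_{i,j} / ℓ_{j,m} for m ∈ A_i
-- (product of the ℓ_{j,k} over k ∈ A_i with k ≠ m)
gDiv : (ℕ → ℕ) → ℕ → (j : ℕ) → ℕ → Poly j
gDiv d i j m = setLast1 (prodP (map (L j) (filterᵇ (λ k → not (k ℕ.≡ᵇ m)) (A d i))))

Mat : ℕ → Set
Mat j = Fin j → Fin j → ℚ

sumFin : ∀ {j} → (Fin j → ℚ) → ℚ
sumFin f = foldr _+_ 0ℚ (map f (allFin _))

_·_ : ∀ {j} → Mat j → Mat j → Mat j
(M · N) i k = sumFin (λ a → M i a * N a k)

idMat : ∀ {j} → Mat j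
idMat i k with toℕ i ℕ.≟ toℕ k
... | yes _ = 1ℚ
... | no _  = 0ℚ

diag : ∀ {j} → (Fin j → ℚ) → Mat j
diag κ i k with toℕ i ℕ.≟ toℕ k
... | yes _ = κ i
... | no _  = 0ℚ

Vand : ∀ {j} → (Fin j → ℕ) → Mat j
Vand z i a = ⟦ z i ℕ.^ toℕ a ⟧ℕ

infix 4 _≐_
infixl 7 _·_
_≐_ : ∀ {j} → Mat j → Mat j → Set
M ≐ N = ∀ i k → M i k ≡ N i k

Invertible : ∀ {j} → Mat j → Set
Invertible {j} M = Σ (Mat j) (λ N → (M · N ≐ idMat) × (N · M ≐ idMat))

Jac : (ℕ → ℕ) → (j : ℕ) → (Fin j → ℚ) → Mat j
Jac d j r i a = eval r (∂ a (g d (toℕ i) j))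

{-# OPTIONS --safe #-}
-- Put zᵢ = eᵢ + cᵢ; these nodes are distinct because they lie in the disjoint blocks Aᵢ.
-- Since ℓ_{j,k}(r) = k^j + Σ_b r_b k^b, the conditions ℓ_{j,zᵢ}(r) = 0 say that r is the
-- coefficient vector of the monic polynomial of degree j with roots z₀ … z_{j-1}, i.e. that
-- Vand(z) r = -(zᵢ^j)ᵢ. The Vandermonde matrix of distinct nodes is invertible: the Lagrange
-- basis gives a right inverse, which is also a left inverse because a polynomial of degree < j
-- with j distinct roots vanishes.
-- Each g_{i,j} is the product of the distinct linear forms ℓ_{j,k}, k ∈ Aᵢ, of which only
-- ℓ_{j,zᵢ} vanishes at r_c, so the product rule gives ∂_a g_{i,j}(r_c) = ∂_a ℓ_{j,zᵢ} · κ_{c,i}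
-- = zᵢ^a κ_{c,i}. The other factors are nonzero at r_c because the monic polynomial of degree j
-- with roots z₀ … z_{j-1} has no further root; hence κ_{c,i} ≠ 0, and J_c = diag(κ_c) · Vand(z)
-- is a product of invertible matrices.
module Submission where

open import Defs

open import Level using (0ℓ)
open import Function using (_∘_; id)
open import Function.Definitions using (Injective)
open import Data.Nat as ℕ using (ℕ; zero; suc; _≤_; _<_; z≤n; s≤s)
import Data.Nat.Properties as ℕP
open import Data.Nat.Coprimality as Coprime using (1-coprimeTo)
import Data.Integer as ℤ
import Data.Integer.Properties as ℤP
open import Data.Rational using (ℚ; 0ℚ; 1ℚ)
import Data.Rational.Properties as ℚP
open import Data.Fin using (Fin; zero; suc; toℕ; inject₁; fromℕ; punchOut)
open import Data.Vec.Functional using (Vector)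
open import Data.Empty using (⊥-elim)
import Data.Fin.Properties as FinP
open import Data.Product using (Σ; _×_; _,_; proj₁; proj₂)
open import Relation.Nullary.Decidable using (dec⇒maybe)
open import Relation.Binary.PropositionalEquality
  using (_≡_; _≢_; refl; sym; trans; cong; cong₂; _≗_; module ≡-Reasoning)
open import Algebra.Bundles using (CommutativeRing)
open import Tactic.RingSolver using (solve-∀)
open import Tactic.RingSolver.Core.AlmostCommutativeRing
  using (AlmostCommutativeRing; fromCommutativeRing)

module RationalArithmetic where

  open import Data.Rational using (_*_; 1/_; _/_; ↥_; mkℚ; ≢-nonZero; +-*-rawSemiring)
  open ≡-Reasoning

  ringℚ : AlmostCommutativeRing 0ℓ 0ℓ
  ringℚ = fromCommutativeRing ℚP.+-*-commutativeRing (λ x → dec⇒maybe (0ℚ ℚP.≟ x))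

  open import Algebra.Properties.Group ℚP.+-0-group public
    using (x∙y⁻¹≈ε⇒x≈y; x≈y⇒x∙y⁻¹≈ε)
  open import Algebra.Definitions.RawSemiring +-*-rawSemiring public
    using (_^_)
  open import Algebra.Properties.Semiring.Sum (CommutativeRing.semiring ℚP.+-*-commutativeRing) public
    using (sum; sum-syntax; sum-cong-≗; ∑-comm; *-distribˡ-sum; *-distribʳ-sum;
           sum-remove; sum-replicate-zero; sum-init-last)

  1≢0 : 1ℚ ≢ 0ℚ
  1≢0 ()

  recip : (x : ℚ) → x ≢ 0ℚ → ℚ
  recip x x≢0 = (1/ x) {{≢-nonZero x≢0}}

  recip-inverseʳ : ∀ x (x≢0 : x ≢ 0ℚ) → x * recip x x≢0 ≡ 1ℚ
  recip-inverseʳ x x≢0 = ℚP.*-inverseʳ x {{≢-nonZero x≢0}}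

  x*y≡0⇒y≡0 : ∀ {x y} → x ≢ 0ℚ → x * y ≡ 0ℚ → y ≡ 0ℚ
  x*y≡0⇒y≡0 {x} {y} x≢0 xy≡0 = begin
    y                       ≡⟨ sym (ℚP.*-identityʳ y) ⟩
    y * 1ℚ                  ≡⟨ cong (y *_) (sym (recip-inverseʳ x x≢0)) ⟩
    y * (x * recip x x≢0)   ≡⟨ regroup y x (recip x x≢0) ⟩
    (x * y) * recip x x≢0   ≡⟨ cong (_* recip x x≢0) xy≡0 ⟩
    0ℚ * recip x x≢0        ≡⟨ ℚP.*-zeroˡ (recip x x≢0) ⟩
    0ℚ                      ∎
    where
    regroup : ∀ a b c → a * (b * c) ≡ (b * a) * c
    regroup = solve-∀ ringℚ

  x≢0∧y≢0⇒x*y≢0 : ∀ {x y} → x ≢ 0ℚ → y ≢ 0ℚ → x * y ≢ 0ℚ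
  x≢0∧y≢0⇒x*y≢0 x≢0 y≢0 = y≢0 ∘ x*y≡0⇒y≡0 x≢0

  ⟦⟧ℕ≡mkℚ : ∀ m → ⟦ m ⟧ℕ ≡ mkℚ (ℤ.+ m) 0 (Coprime.sym (1-coprimeTo m))
  ⟦⟧ℕ≡mkℚ m = ℚP.normalize-coprime (Coprime.sym (1-coprimeTo m))

  ⟦⟧ℕ-injective : Injective _≡_ _≡_ ⟦_⟧ℕ
  ⟦⟧ℕ-injective {m} {n} eq =
    ℤP.+-injective (cong ↥_ (trans (sym (⟦⟧ℕ≡mkℚ m)) (trans eq (⟦⟧ℕ≡mkℚ n))))

  -- The product of the normal forms mkℚ (+ m) 0 _ and mkℚ (+ n) 0 _ computes to (+ m ℤ.* + n) / 1.
  ⟦⟧ℕ-* : ∀ m n → ⟦ m ℕ.* n ⟧ℕ ≡ ⟦ m ⟧ℕ * ⟦ n ⟧ℕ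
  ⟦⟧ℕ-* m n = begin
    ⟦ m ℕ.* n ⟧ℕ                          ≡⟨ cong (_/ 1) (ℤP.pos-* m n) ⟩
    (ℤ.+ m ℤ.* ℤ.+ n) / 1               ≡⟨ cong₂ _*_ (⟦⟧ℕ≡mkℚ m) (⟦⟧ℕ≡mkℚ n) ⟨
    ⟦ m ⟧ℕ * ⟦ n ⟧ℕ                       ∎

  ⟦⟧ℕ-^ : ∀ m k → ⟦ m ℕ.^ k ⟧ℕ ≡ ⟦ m ⟧ℕ ^ k
  ⟦⟧ℕ-^ m zero    = refl
  ⟦⟧ℕ-^ m (suc k) = trans (⟦⟧ℕ-* m (m ℕ.^ k)) (cong (⟦ m ⟧ℕ *_) (⟦⟧ℕ-^ m k))

module Matrices where

  open RationalArithmetic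
  open import Data.Rational using (_+_; _*_)
  import Data.List as List
  open import Data.List.Properties using (map-tabulate)
  open import Data.Vec.Functional using (removeAt)
  open import Relation.Nullary using (yes; no)
  open ≡-Reasoning

  sumFin≡∑ : ∀ {n} (f : Fin n → ℚ) → sumFin f ≡ ∑[ a < n ] f a
  sumFin≡∑ f = trans (cong (List.foldr _+_ 0ℚ) (map-tabulate id f)) (foldr-tabulate f)
    where
    foldr-tabulate : ∀ {n} (f : Fin n → ℚ) → List.foldr _+_ 0ℚ (List.tabulate f) ≡ ∑[ a < n ] f a
    foldr-tabulate {zero}  f = refl
    foldr-tabulate {suc n} f = cong (f zero +_) (foldr-tabulate (f ∘ suc))

  ∑-pick : ∀ {n} (f : Fin n → ℚ) i → (∀ a → a ≢ i → f a ≡ 0ℚ) → ∑[ a < n ] f a ≡ f i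
  ∑-pick {suc n} f i f≡0 = begin
    sum f                      ≡⟨ sum-remove {i = i} f ⟩
    f i + sum (removeAt f i)   ≡⟨ cong (f i +_) removed≡0 ⟩
    f i + 0ℚ                   ≡⟨ ℚP.+-identityʳ (f i) ⟩
    f i                        ∎
    where
    removed≡0 : sum (removeAt f i) ≡ 0ℚ
    removed≡0 = trans (sum-cong-≗ (λ a → f≡0 _ (FinP.punchInᵢ≢i i a))) (sum-replicate-zero n)

  idMat-diagonal : ∀ {n} (i : Fin n) → idMat i i ≡ 1ℚ
  idMat-diagonal i with toℕ i ℕ.≟ toℕ i
  ... | yes _   = refl
  ... | no i≢i  = ⊥-elim (i≢i refl)

  idMat-offDiagonal : ∀ {n} {i k : Fin n} → i ≢ k → idMat i k ≡ 0ℚ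
  idMat-offDiagonal {i = i} {k} i≢k with toℕ i ℕ.≟ toℕ k
  ... | yes i≡k = ⊥-elim (i≢k (FinP.toℕ-injective i≡k))
  ... | no _    = refl

  idMat-inject₁ : ∀ {n} (a b : Fin n) → idMat (inject₁ a) (inject₁ b) ≡ idMat a b
  idMat-inject₁ a b with a FinP.≟ b
  ... | yes refl = trans (idMat-diagonal (inject₁ a)) (sym (idMat-diagonal a))
  ... | no a≢b   = trans (idMat-offDiagonal (a≢b ∘ FinP.inject₁-injective)) (sym (idMat-offDiagonal a≢b))

  diag-diagonal : ∀ {n} (κ : Fin n → ℚ) i → diag κ i i ≡ κ i
  diag-diagonal κ i with toℕ i ℕ.≟ toℕ i
  ... | yes _   = refl
  ... | no i≢i  = ⊥-elim (i≢i refl)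

  diag-offDiagonal : ∀ {n} (κ : Fin n → ℚ) {i k} → i ≢ k → diag κ i k ≡ 0ℚ
  diag-offDiagonal κ {i} {k} i≢k with toℕ i ℕ.≟ toℕ k
  ... | yes i≡k = ⊥-elim (i≢k (FinP.toℕ-injective i≡k))
  ... | no _    = refl

  infixr 7 _*ᵥ_

  _*ᵥ_ : ∀ {n} → Mat n → Vector ℚ n → Vector ℚ n
  _*ᵥ_ {n} M v i = ∑[ a < n ] (M i a * v a)

  column : ∀ {n} → Mat n → Fin n → Vector ℚ n
  column M k a = M a k

  ·≡*ᵥ : ∀ {n} (M N : Mat n) i k → (M · N) i k ≡ (M *ᵥ column N k) i
  ·≡*ᵥ M N i k = sumFin≡∑ (λ a → M i a * N a k)

  *ᵥ-congˡ : ∀ {n} {M M′ : Mat n} → M ≐ M′ → ∀ v → M *ᵥ v ≗ M′ *ᵥ v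
  *ᵥ-congˡ M≐M′ v i = sum-cong-≗ (λ a → cong (_* v a) (M≐M′ i a))

  *ᵥ-congʳ : ∀ {n} (M : Mat n) {u v} → u ≗ v → M *ᵥ u ≗ M *ᵥ v
  *ᵥ-congʳ M u≗v i = sum-cong-≗ (λ a → cong (M i a *_) (u≗v a))

  ·-*ᵥ-assoc : ∀ {n} (M N : Mat n) v → (M · N) *ᵥ v ≗ M *ᵥ (N *ᵥ v)
  ·-*ᵥ-assoc {n} M N v i = begin
    ∑[ b < n ] ((M · N) i b * v b)
      ≡⟨ sum-cong-≗ (λ b → cong (_* v b) (sumFin≡∑ (λ a → M i a * N a b))) ⟩
    ∑[ b < n ] ((∑[ a < n ] (M i a * N a b)) * v b)
      ≡⟨ sum-cong-≗ (λ b → *-distribʳ-sum (v b) (λ a → M i a * N a b)) ⟩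
    ∑[ b < n ] (∑[ a < n ] (M i a * N a b * v b))
      ≡⟨ ∑-comm (λ a b → M i a * N a b * v b) ⟨
    ∑[ a < n ] (∑[ b < n ] (M i a * N a b * v b))
      ≡⟨ sum-cong-≗ (λ a → sum-cong-≗ (λ b → ℚP.*-assoc (M i a) (N a b) (v b))) ⟩
    ∑[ a < n ] (∑[ b < n ] (M i a * (N a b * v b)))
      ≡⟨ sum-cong-≗ (λ a → *-distribˡ-sum (M i a) (λ b → N a b * v b)) ⟨
    ∑[ a < n ] (M i a * (N *ᵥ v) a) ∎

  idMat-*ᵥ : ∀ {n} (v : Vector ℚ n) → idMat *ᵥ v ≗ v
  idMat-*ᵥ v i = begin
    ∑[ a < _ ] (idMat i a * v a)
      ≡⟨ ∑-pick _ i off-diagonal ⟩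
    idMat i i * v i
      ≡⟨ cong (_* v i) (idMat-diagonal i) ⟩
    1ℚ * v i
      ≡⟨ ℚP.*-identityˡ (v i) ⟩
    v i ∎
    where
    off-diagonal : ∀ a → a ≢ i → idMat i a * v a ≡ 0ℚ
    off-diagonal a a≢i = trans (cong (_* v a) (idMat-offDiagonal (a≢i ∘ sym))) (ℚP.*-zeroˡ (v a))

  ·-identityʳ : ∀ {n} (M : Mat n) → M · idMat ≐ M
  ·-identityʳ M i k = begin
    (M · idMat) i k
      ≡⟨ ·≡*ᵥ M idMat i k ⟩
    ∑[ a < _ ] (M i a * idMat a k)
      ≡⟨ ∑-pick _ k off-diagonal ⟩
    M i k * idMat k k
      ≡⟨ cong (M i k *_) (idMat-diagonal k) ⟩
    M i k * 1ℚ
      ≡⟨ ℚP.*-identityʳ (M i k) ⟩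
    M i k ∎
    where
    off-diagonal : ∀ a → a ≢ k → M i a * idMat a k ≡ 0ℚ
    off-diagonal a a≢k = trans (cong (M i a *_) (idMat-offDiagonal a≢k)) (ℚP.*-zeroʳ (M i a))

  ·-identityˡ : ∀ {n} (M : Mat n) → idMat · M ≐ M
  ·-identityˡ M i k = trans (·≡*ᵥ idMat M i k) (idMat-*ᵥ (column M k) i)

  ·-congˡ : ∀ {n} (M : Mat n) {N N′} → N ≐ N′ → M · N ≐ M · N′
  ·-congˡ M {N} {N′} N≐N′ i k = begin
    (M · N) i k              ≡⟨ ·≡*ᵥ M N i k ⟩
    (M *ᵥ column N k) i      ≡⟨ *ᵥ-congʳ M (λ a → N≐N′ a k) i ⟩
    (M *ᵥ column N′ k) i     ≡⟨ ·≡*ᵥ M N′ i k ⟨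
    (M · N′) i k             ∎

  ·-congʳ : ∀ {n} {M M′ : Mat n} → M ≐ M′ → ∀ N → M · N ≐ M′ · N
  ·-congʳ {M = M} {M′} M≐M′ N i k = begin
    (M · N) i k              ≡⟨ ·≡*ᵥ M N i k ⟩
    (M *ᵥ column N k) i      ≡⟨ *ᵥ-congˡ M≐M′ (column N k) i ⟩
    (M′ *ᵥ column N k) i     ≡⟨ ·≡*ᵥ M′ N i k ⟨
    (M′ · N) i k             ∎

  ·-assoc : ∀ {n} (M N P : Mat n) → (M · N) · P ≐ M · (N · P)
  ·-assoc M N P i k = begin
    ((M · N) · P) i k              ≡⟨ ·≡*ᵥ (M · N) P i k ⟩
    ((M · N) *ᵥ column P k) i      ≡⟨ ·-*ᵥ-assoc M N (column P k) i ⟩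
    (M *ᵥ (N *ᵥ column P k)) i     ≡⟨ *ᵥ-congʳ M (λ a → ·≡*ᵥ N P a k) i ⟨
    (M *ᵥ column (N · P) k) i      ≡⟨ ·≡*ᵥ M (N · P) i k ⟨
    (M · (N · P)) i k              ∎

  ·-cancel-middle : ∀ {n} {M N : Mat n} → M · N ≐ idMat → ∀ P Q → (P · M) · (N · Q) ≐ P · Q
  ·-cancel-middle {M = M} {N} MN≐1 P Q i k = begin
    ((P · M) · (N · Q)) i k    ≡⟨ ·-assoc P M (N · Q) i k ⟩
    (P · (M · (N · Q))) i k    ≡⟨ ·-congˡ P (λ a b → sym (·-assoc M N Q a b)) i k ⟩
    (P · ((M · N) · Q)) i k    ≡⟨ ·-congˡ P (·-congʳ MN≐1 Q) i k ⟩
    (P · (idMat · Q)) i k      ≡⟨ ·-congˡ P (·-identityˡ Q) i k ⟩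
    (P · Q) i k                ∎

  Invertible-· : ∀ {n} {M N : Mat n} → Invertible M → Invertible N → Invertible (M · N)
  Invertible-· {M = M} {N} (M⁻¹ , MM⁻¹ , M⁻¹M) (N⁻¹ , NN⁻¹ , N⁻¹N) =
    N⁻¹ · M⁻¹ ,
    (λ i k → trans (·-cancel-middle NN⁻¹ M M⁻¹ i k) (MM⁻¹ i k)) ,
    (λ i k → trans (·-cancel-middle M⁻¹M N⁻¹ N i k) (N⁻¹N i k))

  Invertible-resp-≐ : ∀ {n} {M M′ : Mat n} → M ≐ M′ → Invertible M′ → Invertible M
  Invertible-resp-≐ {M = M} M≐M′ (N , M′N , NM′) =
    N ,
    (λ i k → trans (·-congʳ M≐M′ N i k) (M′N i k)) ,
    (λ i k → trans (·-congˡ N M≐M′ i k) (NM′ i k))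

  diag-· : ∀ {n} (κ : Fin n → ℚ) (M : Mat n) i k → (diag κ · M) i k ≡ κ i * M i k
  diag-· κ M i k = begin
    (diag κ · M) i k
      ≡⟨ ·≡*ᵥ (diag κ) M i k ⟩
    ∑[ a < _ ] (diag κ i a * M a k)
      ≡⟨ ∑-pick _ i off-diagonal ⟩
    diag κ i i * M i k
      ≡⟨ cong (_* M i k) (diag-diagonal κ i) ⟩
    κ i * M i k ∎
    where
    off-diagonal : ∀ a → a ≢ i → diag κ i a * M a k ≡ 0ℚ
    off-diagonal a a≢i = trans (cong (_* M a k) (diag-offDiagonal κ (a≢i ∘ sym))) (ℚP.*-zeroˡ (M a k))

  diag-inverse : ∀ {n} {κ μ : Fin n → ℚ} → (∀ i → κ i * μ i ≡ 1ℚ) → diag κ · diag μ ≐ idMat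
  diag-inverse {κ = κ} {μ} κμ≡1 i k with i FinP.≟ k
  ... | yes refl = begin
    (diag κ · diag μ) i i   ≡⟨ diag-· κ (diag μ) i i ⟩
    κ i * diag μ i i        ≡⟨ cong (κ i *_) (diag-diagonal μ i) ⟩
    κ i * μ i               ≡⟨ κμ≡1 i ⟩
    1ℚ                      ≡⟨ idMat-diagonal i ⟨
    idMat i i               ∎
  ... | no i≢k = begin
    (diag κ · diag μ) i k   ≡⟨ diag-· κ (diag μ) i k ⟩
    κ i * diag μ i k        ≡⟨ cong (κ i *_) (diag-offDiagonal μ i≢k) ⟩
    κ i * 0ℚ                ≡⟨ ℚP.*-zeroʳ (κ i) ⟩
    0ℚ                      ≡⟨ idMat-offDiagonal i≢k ⟨
    idMat i k               ∎

  diag-invertible : ∀ {n} {κ : Fin n → ℚ} → (∀ i → κ i ≢ 0ℚ) → Invertible (diag κ)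
  diag-invertible {κ = κ} κ≢0 =
    diag κ⁻¹ ,
    diag-inverse (λ i → recip-inverseʳ (κ i) (κ≢0 i)) ,
    diag-inverse (λ i → trans (ℚP.*-comm (κ⁻¹ i) (κ i)) (recip-inverseʳ (κ i) (κ≢0 i)))
    where
    κ⁻¹ : Fin _ → ℚ
    κ⁻¹ i = recip (κ i) (κ≢0 i)

  *ᵥ-inverse : ∀ {n} (M N : Mat n) → M · N ≐ idMat → ∀ v → M *ᵥ (N *ᵥ v) ≗ v
  *ᵥ-inverse M N MN≐1 v i = begin
    (M *ᵥ (N *ᵥ v)) i    ≡⟨ ·-*ᵥ-assoc M N v i ⟨
    ((M · N) *ᵥ v) i     ≡⟨ *ᵥ-congˡ MN≐1 v i ⟩
    (idMat *ᵥ v) i       ≡⟨ idMat-*ᵥ v i ⟩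
    v i                  ∎

  solution-unique : ∀ {n} (M N : Mat n) → N · M ≐ idMat → ∀ {u v} → M *ᵥ u ≗ v → u ≗ N *ᵥ v
  solution-unique M N NM≐1 {u} {v} Mu≗v a = begin
    u a                  ≡⟨ *ᵥ-inverse N M NM≐1 u a ⟨
    (N *ᵥ (M *ᵥ u)) a    ≡⟨ *ᵥ-congʳ N Mu≗v a ⟩
    (N *ᵥ v) a           ∎

  rightInverse⇒leftInverse : ∀ {n} (M N : Mat n) → (∀ u v → M *ᵥ u ≗ M *ᵥ v → u ≗ v) →
                             M · N ≐ idMat → N · M ≐ idMat
  rightInverse⇒leftInverse M N M-injective MN≐1 i k =
    M-injective (column (N · M) k) (column idMat k) same-image i
    where
    same-image : M *ᵥ column (N · M) k ≗ M *ᵥ column idMat k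
    same-image a = begin
      (M *ᵥ column (N · M) k) a      ≡⟨ *ᵥ-congʳ M (λ b → ·≡*ᵥ N M b k) a ⟩
      (M *ᵥ (N *ᵥ column M k)) a     ≡⟨ *ᵥ-inverse M N MN≐1 (column M k) a ⟩
      M a k                          ≡⟨ ·-identityʳ M a k ⟨
      (M · idMat) a k                ≡⟨ ·≡*ᵥ M idMat a k ⟩
      (M *ᵥ column idMat k) a        ∎

module CoefficientPolynomials where

  open RationalArithmetic
  open Matrices using (idMat-diagonal; idMat-offDiagonal)
  open import Data.Rational using (_+_; _*_; _-_; -_)
  open import Data.Vec.Functional using (head; tail; _∷_; removeAt; last)
  open import Relation.Nullary using (yes; no)
  open ≡-Reasoning

  infix 8 _at_

  _at_ : ∀ {n} → Vector ℚ n → ℚ → ℚ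
  _at_ {zero}  p t = 0ℚ
  _at_ {suc n} p t = head p + t * (tail p at t)

  at≡∑ : ∀ {n} (p : Vector ℚ n) t → p at t ≡ ∑[ a < n ] (t ^ toℕ a * p a)
  at≡∑ {zero}  p t = refl
  at≡∑ {suc n} p t = begin
    head p + t * (tail p at t)
      ≡⟨ cong (λ s → head p + t * s) (at≡∑ (tail p) t) ⟩
    head p + t * ∑[ a < n ] (t ^ toℕ a * p (suc a))
      ≡⟨ cong₂ _+_ (sym (ℚP.*-identityˡ (head p))) (*-distribˡ-sum t (λ a → t ^ toℕ a * p (suc a))) ⟩
    1ℚ * head p + ∑[ a < n ] (t * (t ^ toℕ a * p (suc a)))
      ≡⟨ cong (1ℚ * head p +_) (sum-cong-≗ (λ a → ℚP.*-assoc t (t ^ toℕ a) (p (suc a)))) ⟨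
    ∑[ a < suc n ] (t ^ toℕ a * p a) ∎

  at-⟦⟧ℕ : ∀ {n} (p : Vector ℚ n) k → ∑[ a < n ] (⟦ k ℕ.^ toℕ a ⟧ℕ * p a) ≡ p at ⟦ k ⟧ℕ
  at-⟦⟧ℕ p k = trans (sum-cong-≗ (λ a → cong (_* p a) (⟦⟧ℕ-^ k (toℕ a)))) (sym (at≡∑ p ⟦ k ⟧ℕ))

  at-sub : ∀ {n} (p q : Vector ℚ n) t → (λ a → p a - q a) at t ≡ p at t - q at t
  at-sub {zero}  p q t = sym (ℚP.+-inverseʳ 0ℚ)
  at-sub {suc n} p q t =
    trans (cong (λ s → head p - head q + t * s) (at-sub (tail p) (tail q) t))
          (distrib (head p) (head q) t (tail p at t) (tail q at t))
    where
    distrib : ∀ a b t x y → a - b + t * (x - y) ≡ (a + t * x) - (b + t * y)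
    distrib = solve-∀ ringℚ

  at-scale : ∀ {n} (p : Vector ℚ n) c t → (λ a → p a * c) at t ≡ p at t * c
  at-scale {zero}  p c t = sym (ℚP.*-zeroˡ c)
  at-scale {suc n} p c t =
    trans (cong (λ s → head p * c + t * s) (at-scale (tail p) c t))
          (distrib (head p) c t (tail p at t))
    where
    distrib : ∀ a c t x → a * c + t * (x * c) ≡ (a + t * x) * c
    distrib = solve-∀ ringℚ

  -- The coefficients of (X - z) p, from (X - z) (p₀ + X p′) = - z p₀ + X (p₀ + (X - z) p′).
  mulLinear : ∀ {n} → ℚ → Vector ℚ n → Vector ℚ (suc n)
  mulLinear {zero}  z p = λ _ → 0ℚ
  mulLinear {suc n} z p = (- (z * head p)) ∷ ((head p + head q) ∷ tail q)
    where
    q : Vector ℚ (suc n)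
    q = mulLinear z (tail p)

  at-mulLinear : ∀ {n} z (p : Vector ℚ n) t → mulLinear z p at t ≡ (t - z) * (p at t)
  at-mulLinear {zero}  z p t = zero-case t z
    where
    zero-case : ∀ t z → 0ℚ + t * 0ℚ ≡ (t - z) * 0ℚ
    zero-case = solve-∀ ringℚ
  at-mulLinear {suc n} z p t = begin
    - (z * p₀) + t * ((p₀ + head q) + t * (tail q at t))
      ≡⟨ regroup p₀ (head q) (tail q at t) t z ⟩
    (t - z) * p₀ + t * (q at t)
      ≡⟨ cong (λ s → (t - z) * p₀ + t * s) (at-mulLinear z (tail p) t) ⟩
    (t - z) * p₀ + t * ((t - z) * (tail p at t))
      ≡⟨ factor p₀ (tail p at t) t z ⟩
    (t - z) * (p₀ + t * (tail p at t)) ∎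
    where
    p₀ : ℚ
    p₀ = head p
    q : Vector ℚ (suc n)
    q = mulLinear z (tail p)
    regroup : ∀ a b c t z → - (z * a) + t * ((a + b) + t * c) ≡ (t - z) * a + t * (b + t * c)
    regroup = solve-∀ ringℚ
    factor : ∀ a b t z → (t - z) * a + t * ((t - z) * b) ≡ (t - z) * (a + t * b)
    factor = solve-∀ ringℚ

  rootPoly : ∀ {n} → Vector ℚ n → Vector ℚ (suc n)
  rootPoly {zero}  z = λ _ → 1ℚ
  rootPoly {suc n} z = mulLinear (head z) (rootPoly (tail z))

  rootPoly-root : ∀ {n} (z : Vector ℚ n) i → rootPoly z at z i ≡ 0ℚ
  rootPoly-root {suc n} z zero = begin
    rootPoly z at z zero
      ≡⟨ at-mulLinear (z zero) (rootPoly (tail z)) (z zero) ⟩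
    (z zero - z zero) * (rootPoly (tail z) at z zero)
      ≡⟨ cong (_* (rootPoly (tail z) at z zero)) (ℚP.+-inverseʳ (z zero)) ⟩
    0ℚ * (rootPoly (tail z) at z zero)
      ≡⟨ ℚP.*-zeroˡ (rootPoly (tail z) at z zero) ⟩
    0ℚ ∎
  rootPoly-root {suc n} z (suc i) = begin
    rootPoly z at z (suc i)
      ≡⟨ at-mulLinear (z zero) (rootPoly (tail z)) (z (suc i)) ⟩
    (z (suc i) - z zero) * (rootPoly (tail z) at z (suc i))
      ≡⟨ cong ((z (suc i) - z zero) *_) (rootPoly-root (tail z) i) ⟩
    (z (suc i) - z zero) * 0ℚ
      ≡⟨ ℚP.*-zeroʳ (z (suc i) - z zero) ⟩
    0ℚ ∎

  rootPoly-nonroot : ∀ {n} (z : Vector ℚ n) {t} → (∀ i → t ≢ z i) → rootPoly z at t ≢ 0ℚ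
  rootPoly-nonroot {zero}  z {t} _ eq = 1≢0 (trans (sym (one t)) eq)
    where
    one : ∀ t → 1ℚ + t * 0ℚ ≡ 1ℚ
    one = solve-∀ ringℚ
  rootPoly-nonroot {suc n} z {t} t∉z eq =
    x≢0∧y≢0⇒x*y≢0 (t∉z zero ∘ x∙y⁻¹≈ε⇒x≈y t (z zero)) (rootPoly-nonroot (tail z) (t∉z ∘ suc))
      (trans (sym (at-mulLinear (z zero) (rootPoly (tail z)) t)) eq)

  divLinear : ∀ {n} → ℚ → Vector ℚ (suc n) → Vector ℚ n
  divLinear {zero}  z p = λ ()
  divLinear {suc n} z p = (tail p at z) ∷ divLinear z (tail p)

  at-divLinear : ∀ {n} z (p : Vector ℚ (suc n)) t → p at t ≡ p at z + (t - z) * (divLinear z p at t)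
  at-divLinear {zero}  z p t = zero-case (head p) t z
    where
    zero-case : ∀ a t z → a + t * 0ℚ ≡ (a + z * 0ℚ) + (t - z) * 0ℚ
    zero-case = solve-∀ ringℚ
  at-divLinear {suc n} z p t = begin
    head p + t * (tail p at t)
      ≡⟨ cong (λ s → head p + t * s) (at-divLinear z (tail p) t) ⟩
    head p + t * (tail p at z + (t - z) * (divLinear z (tail p) at t))
      ≡⟨ regroup (head p) (tail p at z) (divLinear z (tail p) at t) t z ⟩
    (head p + z * (tail p at z)) + (t - z) * (tail p at z + t * (divLinear z (tail p) at t)) ∎
    where
    regroup : ∀ a b c t z → a + t * (b + (t - z) * c) ≡ (a + z * b) + (t - z) * (b + t * c)
    regroup = solve-∀ ringℚ

  head≡0 : ∀ {n} (p : Vector ℚ (suc n)) z → p at z ≡ 0ℚ → tail p at z ≡ 0ℚ → head p ≡ 0ℚ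
  head≡0 p z p[z]≡0 tail[z]≡0 = begin
    head p                       ≡⟨ cancel (head p) z ⟨
    head p + z * 0ℚ              ≡⟨ cong (λ s → head p + z * s) tail[z]≡0 ⟨
    p at z                       ≡⟨ p[z]≡0 ⟩
    0ℚ                           ∎
    where
    cancel : ∀ a z → a + z * 0ℚ ≡ a
    cancel = solve-∀ ringℚ

  divLinear≡0⇒≡0 : ∀ {n} z (p : Vector ℚ (suc n)) → p at z ≡ 0ℚ →
                   (∀ a → divLinear z p a ≡ 0ℚ) → ∀ a → p a ≡ 0ℚ
  divLinear≡0⇒≡0 {zero}  z p p[z]≡0 q≡0 zero    = head≡0 p z p[z]≡0 refl
  divLinear≡0⇒≡0 {suc n} z p p[z]≡0 q≡0 zero    = head≡0 p z p[z]≡0 (q≡0 zero)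
  divLinear≡0⇒≡0 {suc n} z p p[z]≡0 q≡0 (suc a) = divLinear≡0⇒≡0 z (tail p) (q≡0 zero) (q≡0 ∘ suc) a

  roots⇒≡0 : ∀ {n} (p z : Vector ℚ n) → Injective _≡_ _≡_ z →
             (∀ i → p at z i ≡ 0ℚ) → ∀ a → p a ≡ 0ℚ
  roots⇒≡0 {suc n} p z z-injective roots =
    divLinear≡0⇒≡0 (z zero) p (roots zero) (roots⇒≡0 q (tail z) (FinP.suc-injective ∘ z-injective) q-roots)
    where
    q : Vector ℚ n
    q = divLinear (z zero) p
    q-roots : ∀ i → q at z (suc i) ≡ 0ℚ
    q-roots i = x*y≡0⇒y≡0 (FinP.0≢1+n ∘ sym ∘ z-injective ∘ x∙y⁻¹≈ε⇒x≈y _ _) (begin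
      (z (suc i) - z zero) * (q at z (suc i))
        ≡⟨ ℚP.+-identityˡ ((z (suc i) - z zero) * (q at z (suc i))) ⟨
      0ℚ + (z (suc i) - z zero) * (q at z (suc i))
        ≡⟨ cong (_+ (z (suc i) - z zero) * (q at z (suc i))) (roots zero) ⟨
      p at z zero + (z (suc i) - z zero) * (q at z (suc i))
        ≡⟨ at-divLinear (z zero) p (z (suc i)) ⟨
      p at z (suc i)
        ≡⟨ roots (suc i) ⟩
      0ℚ ∎)

  no-extra-root : ∀ {n} (p : Vector ℚ (suc n)) → last p ≢ 0ℚ →
                  (z : Vector ℚ n) → Injective _≡_ _≡_ z → (∀ i → p at z i ≡ 0ℚ) →
                  ∀ {t} → (∀ i → t ≢ z i) → p at t ≢ 0ℚ
  no-extra-root {n} p p-last≢0 z z-injective roots {t} t∉z p[t]≡0 =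
    p-last≢0 (roots⇒≡0 p (t ∷ z) t∷z-injective t∷z-roots (fromℕ n))
    where
    t∷z-roots : ∀ i → p at (t ∷ z) i ≡ 0ℚ
    t∷z-roots zero    = p[t]≡0
    t∷z-roots (suc i) = roots i
    t∷z-injective : Injective _≡_ _≡_ (t ∷ z)
    t∷z-injective {zero}  {zero}  _  = refl
    t∷z-injective {zero}  {suc k} eq = ⊥-elim (t∉z k eq)
    t∷z-injective {suc i} {zero}  eq = ⊥-elim (t∉z i (sym eq))
    t∷z-injective {suc i} {suc k} eq = cong suc (z-injective eq)

  rootPoly-removeAt-nonroot : ∀ {n} (z : Vector ℚ (suc n)) → Injective _≡_ _≡_ z →
                              ∀ k → rootPoly (removeAt z k) at z k ≢ 0ℚ
  rootPoly-removeAt-nonroot z z-injective k =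
    rootPoly-nonroot (removeAt z k) (λ i → FinP.punchInᵢ≢i k i ∘ sym ∘ z-injective)

  lagrangeBasis : ∀ {n} (z : Vector ℚ (suc n)) → Injective _≡_ _≡_ z → Fin (suc n) → Vector ℚ (suc n)
  lagrangeBasis z z-injective k a =
    rootPoly (removeAt z k) a *
    recip (rootPoly (removeAt z k) at z k) (rootPoly-removeAt-nonroot z z-injective k)

  lagrangeBasis-at : ∀ {n} (z : Vector ℚ (suc n)) (z-injective : Injective _≡_ _≡_ z) i k →
                     lagrangeBasis z z-injective k at z i ≡ idMat i k
  lagrangeBasis-at z z-injective i k with i FinP.≟ k
  ... | yes refl = begin
    lagrangeBasis z z-injective i at z i    ≡⟨ at-scale (rootPoly (removeAt z i)) _ (z i) ⟩
    c * recip c c≢0                         ≡⟨ recip-inverseʳ c c≢0 ⟩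
    1ℚ                                      ≡⟨ idMat-diagonal i ⟨
    idMat i i                               ∎
    where
    c : ℚ
    c = rootPoly (removeAt z i) at z i
    c≢0 : c ≢ 0ℚ
    c≢0 = rootPoly-removeAt-nonroot z z-injective i
  ... | no i≢k = begin
    lagrangeBasis z z-injective k at z i    ≡⟨ at-scale (rootPoly (removeAt z k)) c⁻¹ (z i) ⟩
    (rootPoly (removeAt z k) at z i) * c⁻¹  ≡⟨ cong (_* c⁻¹) z[i]≡0 ⟩
    0ℚ * c⁻¹                                ≡⟨ ℚP.*-zeroˡ c⁻¹ ⟩
    0ℚ                                      ≡⟨ idMat-offDiagonal i≢k ⟨
    idMat i k                               ∎
    where
    c⁻¹ : ℚ
    c⁻¹ = recip (rootPoly (removeAt z k) at z k) (rootPoly-removeAt-nonroot z z-injective k)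
    z[i]≡0 : rootPoly (removeAt z k) at z i ≡ 0ℚ
    z[i]≡0 = trans (cong (λ a → rootPoly (removeAt z k) at z a) (sym (FinP.punchIn-punchOut (i≢k ∘ sym))))
                   (rootPoly-root (removeAt z k) (punchOut (i≢k ∘ sym)))

module Vandermonde where

  open RationalArithmetic
  open Matrices
  open CoefficientPolynomials
  open import Data.Rational using (_-_)
  open ≡-Reasoning

  Vand-*ᵥ : ∀ {n} (m : Fin n → ℕ) p i → (Vand m *ᵥ p) i ≡ p at ⟦ m i ⟧ℕ
  Vand-*ᵥ m p i = at-⟦⟧ℕ p (m i)

  Vand-*ᵥ-injective : ∀ {n} (m : Fin n → ℕ) → Injective _≡_ _≡_ m →
                      ∀ u v → Vand m *ᵥ u ≗ Vand m *ᵥ v → u ≗ v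
  Vand-*ᵥ-injective m m-injective u v Vu≗Vv a =
    x∙y⁻¹≈ε⇒x≈y (u a) (v a)
      (roots⇒≡0 (λ b → u b - v b) (⟦_⟧ℕ ∘ m) (m-injective ∘ ⟦⟧ℕ-injective) roots a)
    where
    roots : ∀ i → (λ b → u b - v b) at ⟦ m i ⟧ℕ ≡ 0ℚ
    roots i = begin
      (λ b → u b - v b) at ⟦ m i ⟧ℕ         ≡⟨ at-sub u v ⟦ m i ⟧ℕ ⟩
      u at ⟦ m i ⟧ℕ - v at ⟦ m i ⟧ℕ         ≡⟨ cong₂ _-_ (Vand-*ᵥ m u i) (Vand-*ᵥ m v i) ⟨
      (Vand m *ᵥ u) i - (Vand m *ᵥ v) i     ≡⟨ x≈y⇒x∙y⁻¹≈ε (Vu≗Vv i) ⟩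
      0ℚ                                    ∎

  Vand-invertible : ∀ {n} (m : Fin n → ℕ) → Injective _≡_ _≡_ m → Invertible (Vand m)
  Vand-invertible {zero}  m _ = (λ ()) , (λ ()) , (λ ())
  Vand-invertible {suc n} m m-injective =
    N , VN≐1 , rightInverse⇒leftInverse (Vand m) N (Vand-*ᵥ-injective m m-injective) VN≐1
    where
    z-injective : Injective _≡_ _≡_ (⟦_⟧ℕ ∘ m)
    z-injective = m-injective ∘ ⟦⟧ℕ-injective
    N : Mat (suc n)
    N a k = lagrangeBasis (⟦_⟧ℕ ∘ m) z-injective k a
    VN≐1 : Vand m · N ≐ idMat
    VN≐1 i k = begin
      (Vand m · N) i k              ≡⟨ ·≡*ᵥ (Vand m) N i k ⟩
      (Vand m *ᵥ column N k) i      ≡⟨ Vand-*ᵥ m (column N k) i ⟩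
      column N k at ⟦ m i ⟧ℕ        ≡⟨ lagrangeBasis-at (⟦_⟧ℕ ∘ m) z-injective i k ⟩
      idMat i k                     ∎

module PolynomialExpressions where

  open RationalArithmetic
  open Matrices using (sumFin≡∑; ∑-pick; idMat-diagonal; idMat-offDiagonal; idMat-inject₁)
  open CoefficientPolynomials
  open import Data.Rational using (_+_; _*_)
  open import Data.Bool using (true; false; not; T)
  open import Data.Unit using (tt)
  import Data.Maybe as Maybe
  open import Data.Maybe using (just; nothing; maybe′)
  open import Data.List using (List; []; _∷_; map; allFin; filterᵇ)
  import Data.List as List
  open import Data.List.Properties using (map-∘)
  open import Data.List.Relation.Unary.All using (All; []; _∷_)
  open import Data.List.Relation.Unary.Any as Any using (here; there)
  open import Data.List.Membership.Propositional using (_∈_)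
  open import Data.List.Relation.Unary.Unique.Propositional using (Unique)
  open import Data.List.Relation.Unary.AllPairs using (_∷_)
  open import Data.Fin.Relation.Unary.Top using (view; ‵fromℕ; ‵inject₁)
  open import Relation.Nullary using (yes; no)
  import Relation.Binary.PropositionalEquality as ≡
  open ≡-Reasoning

  -- snoc1 r is both the point (r, 1) at which setLast1 P is evaluated and the coefficient
  -- vector of the monic polynomial X^j + Σ_b r_b X^b.
  snoc1 : ∀ {j} → Vector ℚ j → Vector ℚ (suc j)
  snoc1 r b = maybe′ r 1ℚ (splitLast b)

  splitLast-inject₁ : ∀ {j} (b : Fin j) → splitLast (inject₁ b) ≡ just b
  splitLast-inject₁ {suc j} zero    = refl
  splitLast-inject₁ {suc j} (suc b) = cong (Maybe.map suc) (splitLast-inject₁ b)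

  splitLast-fromℕ : ∀ j → splitLast (fromℕ j) ≡ nothing
  splitLast-fromℕ zero    = refl
  splitLast-fromℕ (suc j) = cong (Maybe.map suc) (splitLast-fromℕ j)

  snoc1-inject₁ : ∀ {j} (r : Vector ℚ j) b → snoc1 r (inject₁ b) ≡ r b
  snoc1-inject₁ r b = cong (maybe′ r 1ℚ) (splitLast-inject₁ b)

  snoc1-last : ∀ {j} (r : Vector ℚ j) → snoc1 r (fromℕ j) ≡ 1ℚ
  snoc1-last {j} r = cong (maybe′ r 1ℚ) (splitLast-fromℕ j)

  at-snoc1 : ∀ {j} (r : Vector ℚ j) t → snoc1 r at t ≡ r at t + t ^ j
  at-snoc1 {j} r t = begin
    snoc1 r at t                                       ≡⟨ at≡∑ (snoc1 r) t ⟩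
    ∑[ b < suc j ] (t ^ toℕ b * snoc1 r b)             ≡⟨ sum-init-last (λ b → t ^ toℕ b * snoc1 r b) ⟩
    ∑[ b < j ] (t ^ toℕ (inject₁ b) * snoc1 r (inject₁ b))
      + t ^ toℕ (fromℕ j) * snoc1 r (fromℕ j)          ≡⟨ cong₂ _+_ (sum-cong-≗ init≗) last≡ ⟩
    ∑[ b < j ] (t ^ toℕ b * r b) + t ^ j               ≡⟨ cong (_+ t ^ j) (at≡∑ r t) ⟨
    r at t + t ^ j                                     ∎
    where
    init≗ : ∀ b → t ^ toℕ (inject₁ b) * snoc1 r (inject₁ b) ≡ t ^ toℕ b * r b
    init≗ b = cong₂ (λ k x → t ^ k * x) (FinP.toℕ-inject₁ b) (snoc1-inject₁ r b)
    last≡ : t ^ toℕ (fromℕ j) * snoc1 r (fromℕ j) ≡ t ^ j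
    last≡ = trans (cong₂ (λ k x → t ^ k * x) (FinP.toℕ-fromℕ j) (snoc1-last r)) (ℚP.*-identityʳ (t ^ j))

  eval-setLast1 : ∀ {j} (r : Fin j → ℚ) P → eval r (setLast1 P) ≡ eval (snoc1 r) P
  eval-setLast1 r (con q) = refl
  eval-setLast1 r (var b) with splitLast b
  ... | just _  = refl
  ... | nothing = refl
  eval-setLast1 r (P ⊕ Q) = cong₂ _+_ (eval-setLast1 r P) (eval-setLast1 r Q)
  eval-setLast1 r (P ⊗ Q) = cong₂ _*_ (eval-setLast1 r P) (eval-setLast1 r Q)

  setLast1-var-inject₁ : ∀ {j} (b : Fin j) → setLast1 (var (inject₁ b)) ≡ var b
  setLast1-var-inject₁ b rewrite splitLast-inject₁ b = refl

  setLast1-var-fromℕ : ∀ j → setLast1 {j} (var (fromℕ j)) ≡ con 1ℚ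
  setLast1-var-fromℕ j rewrite splitLast-fromℕ j = refl

  ∂-var : ∀ {v} (a b : Fin v) → ∂ a (var b) ≡ con (idMat a b)
  ∂-var a b with toℕ a ℕ.≟ toℕ b
  ... | yes _ = refl
  ... | no _  = refl

  ∂-setLast1 : ∀ {j} (a : Fin j) P → ∂ a (setLast1 P) ≡ setLast1 (∂ (inject₁ a) P)
  ∂-setLast1 a (con q) = refl
  ∂-setLast1 {j} a (var b) with view b
  ... | ‵fromℕ = begin
    ∂ a (setLast1 (var (fromℕ j)))
      ≡⟨ cong (∂ a) (setLast1-var-fromℕ j) ⟩
    con 0ℚ
      ≡⟨ cong con (idMat-offDiagonal {i = inject₁ a} {fromℕ j} (FinP.fromℕ≢inject₁ ∘ sym)) ⟨
    con (idMat (inject₁ a) (fromℕ j))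
      ≡⟨ cong setLast1 (∂-var (inject₁ a) (fromℕ j)) ⟨
    setLast1 (∂ (inject₁ a) (var (fromℕ j))) ∎
  ... | ‵inject₁ b′ = begin
    ∂ a (setLast1 (var (inject₁ b′)))           ≡⟨ cong (∂ a) (setLast1-var-inject₁ b′) ⟩
    ∂ a (var b′)                                ≡⟨ ∂-var a b′ ⟩
    con (idMat a b′)                            ≡⟨ cong con (idMat-inject₁ a b′) ⟨
    con (idMat (inject₁ a) (inject₁ b′))        ≡⟨ cong setLast1 (∂-var (inject₁ a) (inject₁ b′)) ⟨
    setLast1 (∂ (inject₁ a) (var (inject₁ b′))) ∎
  ∂-setLast1 a (P ⊕ Q) = cong₂ _⊕_ (∂-setLast1 a P) (∂-setLast1 a Q)
  ∂-setLast1 a (P ⊗ Q) =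
    cong₂ (λ ∂P ∂Q → ∂P ⊗ setLast1 Q ⊕ setLast1 P ⊗ ∂Q) (∂-setLast1 a P) (∂-setLast1 a Q)

  linearForm : ∀ {v} → Vector ℚ v → Poly v
  linearForm {v} c = sumP (map (λ a → con (c a) ⊗ var a) (allFin v))

  eval-sumP : ∀ {v} (s : Fin v → ℚ) Ps → eval s (sumP Ps) ≡ List.foldr _+_ 0ℚ (map (eval s) Ps)
  eval-sumP s []       = refl
  eval-sumP s (P ∷ Ps) = cong (eval s P +_) (eval-sumP s Ps)

  eval-sumP-allFin : ∀ {v w} (s : Fin w → ℚ) (f : Fin v → Poly w) →
                     eval s (sumP (map f (allFin v))) ≡ ∑[ a < v ] eval s (f a)
  eval-sumP-allFin {v} s f = begin
    eval s (sumP (map f (allFin v)))                     ≡⟨ eval-sumP s (map f (allFin v)) ⟩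
    List.foldr _+_ 0ℚ (map (eval s) (map f (allFin v)))  ≡⟨ cong (List.foldr _+_ 0ℚ) (map-∘ (allFin v)) ⟨
    sumFin (eval s ∘ f)                                  ≡⟨ sumFin≡∑ (eval s ∘ f) ⟩
    ∑[ a < v ] eval s (f a)                              ∎

  ∂-sumP-map : ∀ {v} {A : Set} (a : Fin v) (f : A → Poly v) xs →
               ∂ a (sumP (map f xs)) ≡ sumP (map (∂ a ∘ f) xs)
  ∂-sumP-map a f []       = refl
  ∂-sumP-map a f (x ∷ xs) = cong (∂ a (f x) ⊕_) (∂-sumP-map a f xs)

  eval-linearForm : ∀ {v} (s : Fin v → ℚ) c → eval s (linearForm c) ≡ ∑[ a < v ] (c a * s a)
  eval-linearForm s c = eval-sumP-allFin s (λ a → con (c a) ⊗ var a)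

  eval-∂-linearForm : ∀ {v} (s : Fin v → ℚ) a c → eval s (∂ a (linearForm c)) ≡ c a
  eval-∂-linearForm {v} s a c = begin
    eval s (∂ a (linearForm c))                      ≡⟨ cong (eval s) (∂-sumP-map a term (allFin v)) ⟩
    eval s (sumP (map (∂ a ∘ term) (allFin v)))      ≡⟨ eval-sumP-allFin s (∂ a ∘ term) ⟩
    ∑[ b < v ] eval s (∂ a (term b))                 ≡⟨ ∑-pick _ a off-diagonal ⟩
    eval s (∂ a (term a))                            ≡⟨ ∂term a ⟩
    c a * idMat a a                                  ≡⟨ cong (c a *_) (idMat-diagonal a) ⟩
    c a * 1ℚ                                         ≡⟨ ℚP.*-identityʳ (c a) ⟩
    c a                                              ∎
    where
    term : Fin v → Poly v
    term b = con (c b) ⊗ var b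
    ∂term : ∀ b → eval s (∂ a (term b)) ≡ c b * idMat a b
    ∂term b = begin
      0ℚ * s b + c b * eval s (∂ a (var b))   ≡⟨ cong (λ P → 0ℚ * s b + c b * eval s P) (∂-var a b) ⟩
      0ℚ * s b + c b * idMat a b              ≡⟨ cong (_+ c b * idMat a b) (ℚP.*-zeroˡ (s b)) ⟩
      0ℚ + c b * idMat a b                    ≡⟨ ℚP.+-identityˡ (c b * idMat a b) ⟩
      c b * idMat a b                         ∎
    off-diagonal : ∀ b → b ≢ a → eval s (∂ a (term b)) ≡ 0ℚ
    off-diagonal b b≢a = trans (∂term b) (trans (cong (c b *_) (idMat-offDiagonal (b≢a ∘ sym))) (ℚP.*-zeroʳ (c b)))

  eval-L : ∀ {j} (s : Fin (suc j) → ℚ) k → eval s (L j k) ≡ s at ⟦ k ⟧ℕ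
  eval-L s k = trans (eval-linearForm s (λ a → ⟦ k ℕ.^ toℕ a ⟧ℕ)) (at-⟦⟧ℕ s k)

  eval-∂-L : ∀ {j} (s : Fin (suc j) → ℚ) a k → eval s (∂ a (L j k)) ≡ ⟦ k ℕ.^ toℕ a ⟧ℕ
  eval-∂-L s a k = eval-∂-linearForm s a (λ b → ⟦ k ℕ.^ toℕ b ⟧ℕ)

  eval-ℓ : ∀ {j} (r : Fin j → ℚ) k → eval r (ℓ j k) ≡ snoc1 r at ⟦ k ⟧ℕ
  eval-ℓ {j} r k = trans (eval-setLast1 r (L j k)) (eval-L (snoc1 r) k)

  filterOut : ℕ → List ℕ → List ℕ
  filterOut m = filterᵇ (λ k → not (k ℕ.≡ᵇ m))

  filterOut-head : ∀ m ks → filterOut m (m ∷ ks) ≡ filterOut m ks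
  filterOut-head m ks with m ℕ.≡ᵇ m in m≡ᵇm
  ... | true  = refl
  ... | false = ⊥-elim (≡.subst T m≡ᵇm (ℕP.≡⇒≡ᵇ m m refl))

  filterOut-≢ : ∀ {m k} ks → k ≢ m → filterOut m (k ∷ ks) ≡ k ∷ filterOut m ks
  filterOut-≢ {m} {k} ks k≢m with k ℕ.≡ᵇ m in k≡ᵇm
  ... | true  = ⊥-elim (k≢m (ℕP.≡ᵇ⇒≡ k m (≡.subst T (sym k≡ᵇm) tt)))
  ... | false = refl

  filterOut-∉ : ∀ {m ks} → All (m ≢_) ks → filterOut m ks ≡ ks
  filterOut-∉ []                            = refl
  filterOut-∉ {ks = k ∷ ks} (m≢k ∷ m∉ks) =
    trans (filterOut-≢ ks (m≢k ∘ sym)) (cong (k ∷_) (filterOut-∉ m∉ks))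

  filterOut⁺ : ∀ {Q : ℕ → Set} {m} ks → All (λ k → k ≢ m → Q k) ks → All Q (filterOut m ks)
  filterOut⁺ []       []         = []
  filterOut⁺ {Q} {m} (k ∷ ks) (Qk ∷ Qks) with k ℕ.≟ m
  ... | yes refl = ≡.subst (All Q) (sym (filterOut-head k ks)) (filterOut⁺ ks Qks)
  ... | no k≢m   = ≡.subst (All Q) (sym (filterOut-≢ ks k≢m)) (Qk k≢m ∷ filterOut⁺ ks Qks)

  module _ {v} (f : ℕ → Poly v) (s : Fin v → ℚ) where

    private
      value : ℕ → ℚ
      value k = eval s (f k)
      ∂value : Fin v → ℕ → ℚ
      ∂value a k = eval s (∂ a (f k))
      Π : List ℕ → ℚ
      Π ks = eval s (prodP (map f ks))
      ∂Π : Fin v → List ℕ → ℚ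
      ∂Π a ks = eval s (∂ a (prodP (map f ks)))

    eval-prodP-root : ∀ {m ks} → m ∈ ks → eval s (f m) ≡ 0ℚ → eval s (prodP (map f ks)) ≡ 0ℚ
    eval-prodP-root {ks = k ∷ ks} (here refl)  f[m]≡0 =
      trans (cong (_* Π ks) f[m]≡0) (ℚP.*-zeroˡ (Π ks))
    eval-prodP-root {ks = k ∷ ks} (there m∈ks) f[m]≡0 =
      trans (cong (value k *_) (eval-prodP-root m∈ks f[m]≡0)) (ℚP.*-zeroʳ (value k))

    eval-prodP-≢0 : ∀ {ks} → All (λ k → eval s (f k) ≢ 0ℚ) ks → eval s (prodP (map f ks)) ≢ 0ℚ
    eval-prodP-≢0 []                 = λ ()
    eval-prodP-≢0 (f[k]≢0 ∷ f[ks]≢0) = x≢0∧y≢0⇒x*y≢0 f[k]≢0 (eval-prodP-≢0 f[ks]≢0)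

    eval-∂-prodP-simpleRoot : ∀ a {m ks} → Unique ks → m ∈ ks → eval s (f m) ≡ 0ℚ →
      eval s (∂ a (prodP (map f ks))) ≡ eval s (∂ a (f m)) * eval s (prodP (map f (filterOut m ks)))
    eval-∂-prodP-simpleRoot a {m} {k ∷ ks} (k∉ks ∷ ks-unique) m∈k∷ks f[m]≡0 with k ℕ.≟ m
    ... | yes refl = begin
      ∂value a k * Π ks + value k * ∂Π a ks
        ≡⟨ cong (λ x → ∂value a k * Π ks + x * ∂Π a ks) f[m]≡0 ⟩
      ∂value a k * Π ks + 0ℚ * ∂Π a ks
        ≡⟨ drop (∂value a k * Π ks) (∂Π a ks) ⟩
      ∂value a k * Π ks
        ≡⟨ cong (λ ks′ → ∂value a k * Π ks′) (trans (filterOut-head k ks) (filterOut-∉ k∉ks)) ⟨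
      ∂value a k * Π (filterOut k (k ∷ ks)) ∎
      where
      drop : ∀ x y → x + 0ℚ * y ≡ x
      drop = solve-∀ ringℚ
    ... | no k≢m = begin
      ∂value a k * Π ks + value k * ∂Π a ks
        ≡⟨ cong₂ (λ x y → ∂value a k * x + value k * y) (eval-prodP-root m∈ks f[m]≡0)
                 (eval-∂-prodP-simpleRoot a ks-unique m∈ks f[m]≡0) ⟩
      ∂value a k * 0ℚ + value k * (∂value a m * Π (filterOut m ks))
        ≡⟨ regroup (∂value a k) (value k) (∂value a m) (Π (filterOut m ks)) ⟩
      ∂value a m * (value k * Π (filterOut m ks))
        ≡⟨ cong (λ ks′ → ∂value a m * Π ks′) (filterOut-≢ ks k≢m) ⟨
      ∂value a m * Π (filterOut m (k ∷ ks)) ∎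
      where
      m∈ks : m ∈ ks
      m∈ks = Any.tail (k≢m ∘ sym) m∈k∷ks
      regroup : ∀ w x y z → w * 0ℚ + x * (y * z) ≡ y * (x * z)
      regroup = solve-∀ ringℚ

module Blocks where

  open import Data.Nat using (_+_; _≤′_; ≤′-refl; ≤′-step)
  open import Data.List.Membership.Propositional using (_∈_)
  open import Data.List.Membership.Propositional.Properties using (∈-map⁺; ∈-map⁻; ∈-upTo⁺; ∈-upTo⁻)
  open import Data.List.Relation.Unary.Unique.Propositional using (Unique)
  import Data.List.Relation.Unary.Unique.Propositional.Properties as Unique
  open import Relation.Binary.Definitions using (tri<; tri≈; tri>)

  InBlock : (ℕ → ℕ) → ℕ → ℕ → Set
  InBlock d i k = e d i < k × k ≤ e d (suc i)

  e-mono : ∀ d {i i′} → i ≤ i′ → e d i ≤ e d i′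
  e-mono d = mono ∘ ℕP.≤⇒≤′
    where
    mono : ∀ {i i′} → i ≤′ i′ → e d i ≤ e d i′
    mono ≤′-refl          = ℕP.≤-refl
    mono (≤′-step i≤′i′) = ℕP.≤-trans (mono i≤′i′) (ℕP.m≤m+n _ _)

  InBlock-< : ∀ d {i i′ k k′} → i < i′ → InBlock d i k → InBlock d i′ k′ → k < k′
  InBlock-< d i<i′ (_ , k≤e) (e′<k′ , _) = ℕP.≤-<-trans (ℕP.≤-trans k≤e (e-mono d i<i′)) e′<k′

  InBlock-unique : ∀ d {i i′ k} → InBlock d i k → InBlock d i′ k → i ≡ i′
  InBlock-unique d {i} {i′} k∈Bᵢ k∈Bᵢ′ with ℕP.<-cmp i i′
  ... | tri< i<i′ _ _ = ⊥-elim (ℕP.<-irrefl refl (InBlock-< d i<i′ k∈Bᵢ k∈Bᵢ′))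
  ... | tri≈ _ i≡i′ _ = i≡i′
  ... | tri> _ _ i′<i = ⊥-elim (ℕP.<-irrefl refl (InBlock-< d i′<i k∈Bᵢ′ k∈Bᵢ))

  ∈A⇒InBlock : ∀ d {i k} → k ∈ A d i → InBlock d i k
  ∈A⇒InBlock d {i} k∈A with ∈-map⁻ (λ t → e d i + suc t) k∈A
  ... | t , t∈upTo , refl = ℕP.m<m+n (e d i) (s≤s z≤n) , ℕP.+-monoʳ-≤ (e d i) (∈-upTo⁻ t∈upTo)

  +-∈A : ∀ d {i c} → 1 ≤ c → c ≤ d i → e d i + c ∈ A d i
  +-∈A d {i} {suc t} _ c≤d = ∈-map⁺ (λ t → e d i + suc t) (∈-upTo⁺ c≤d)

  A-unique : ∀ d i → Unique (A d i)
  A-unique d i = Unique.map⁺ (ℕP.suc-injective ∘ ℕP.+-cancelˡ-≡ (e d i) _ _) (Unique.upTo⁺ (d i))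

module Jacobian (d : ℕ → ℕ) {j : ℕ} (c : Fin j → ℕ)
                (c-bounds : ∀ i → 1 ≤ c i × c i ≤ d (toℕ i)) where

  open RationalArithmetic
  open Matrices
  open CoefficientPolynomials
  open Vandermonde
  open PolynomialExpressions
  open Blocks
  open import Data.Rational using (_+_; _*_; -_)
  open import Data.List using (map)
  open import Data.List.Membership.Propositional using (_∈_)
  open import Data.List.Relation.Unary.All using (tabulate)
  import Relation.Binary.PropositionalEquality as ≡
  open import Algebra.Properties.Group ℚP.+-0-group using (inverseˡ-unique)
  open ≡-Reasoning

  node : Fin j → ℕ
  node i = e d (toℕ i) ℕ.+ c i

  node-∈A : ∀ i → node i ∈ A d (toℕ i)
  node-∈A i = +-∈A d (proj₁ (c-bounds i)) (proj₂ (c-bounds i))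

  node-InBlock : ∀ i → InBlock d (toℕ i) (node i)
  node-InBlock i = ∈A⇒InBlock d (node-∈A i)

  node-injective : Injective _≡_ _≡_ node
  node-injective {i} {i′} eq =
    FinP.toℕ-injective
      (InBlock-unique d (node-InBlock i) (≡.subst (InBlock d (toℕ i′)) (sym eq) (node-InBlock i′)))

  A-nonnode : ∀ {i k} → k ∈ A d (toℕ i) → k ≢ node i → ∀ i′ → k ≢ node i′
  A-nonnode {i} k∈A k≢node i′ refl =
    k≢node (cong node (FinP.toℕ-injective (InBlock-unique d (node-InBlock i′) (∈A⇒InBlock d k∈A))))

  Roots : (Fin j → ℚ) → Set
  Roots r = ∀ i → eval r (ℓ j (node i)) ≡ 0ℚ

  negPowers : Vector ℚ j
  negPowers i = - (⟦ node i ⟧ℕ ^ j)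

  eval-ℓ-node : ∀ r i → eval r (ℓ j (node i)) ≡ (Vand node *ᵥ r) i + ⟦ node i ⟧ℕ ^ j
  eval-ℓ-node r i = begin
    eval r (ℓ j (node i))                         ≡⟨ eval-ℓ r (node i) ⟩
    snoc1 r at ⟦ node i ⟧ℕ                        ≡⟨ at-snoc1 r ⟦ node i ⟧ℕ ⟩
    r at ⟦ node i ⟧ℕ + ⟦ node i ⟧ℕ ^ j            ≡⟨ cong (_+ ⟦ node i ⟧ℕ ^ j) (Vand-*ᵥ node r i) ⟨
    (Vand node *ᵥ r) i + ⟦ node i ⟧ℕ ^ j          ∎

  Roots⇒Vand : ∀ {r} → Roots r → Vand node *ᵥ r ≗ negPowers
  Roots⇒Vand {r} roots i = inverseˡ-unique _ _ (trans (sym (eval-ℓ-node r i)) (roots i))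

  Vand⇒Roots : ∀ {r} → Vand node *ᵥ r ≗ negPowers → Roots r
  Vand⇒Roots {r} Vr≗negPowers i = begin
    eval r (ℓ j (node i))                         ≡⟨ eval-ℓ-node r i ⟩
    (Vand node *ᵥ r) i + ⟦ node i ⟧ℕ ^ j          ≡⟨ cong (_+ ⟦ node i ⟧ℕ ^ j) (Vr≗negPowers i) ⟩
    - (⟦ node i ⟧ℕ ^ j) + ⟦ node i ⟧ℕ ^ j         ≡⟨ ℚP.+-inverseˡ (⟦ node i ⟧ℕ ^ j) ⟩
    0ℚ                                            ∎

  UniqueRoot : Set
  UniqueRoot = Σ (Fin j → ℚ) (λ r → Roots r × (∀ r′ → Roots r′ → ∀ a → r′ a ≡ r a))

  uniqueRoot : UniqueRoot
  uniqueRoot = solve (Vand-invertible node node-injective)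
    where
    solve : Invertible (Vand node) → UniqueRoot
    solve (N , VN≐1 , NV≐1) =
      N *ᵥ negPowers ,
      Vand⇒Roots (*ᵥ-inverse (Vand node) N VN≐1 negPowers) ,
      λ r′ roots′ → solution-unique (Vand node) N NV≐1 (Roots⇒Vand roots′)

  module _ (r : Fin j → ℚ) (roots : Roots r) where

    snoc1-roots : ∀ i → snoc1 r at ⟦ node i ⟧ℕ ≡ 0ℚ
    snoc1-roots i = trans (sym (eval-ℓ r (node i))) (roots i)

    -- gDiv d (toℕ i) j (node i) is setLast1 (Πᵢ i).
    Πᵢ : Fin j → Poly (suc j)
    Πᵢ i = prodP (map (L j) (filterOut (node i) (A d (toℕ i))))

    κ : Fin j → ℚ
    κ i = eval r (gDiv d (toℕ i) j (node i))

    κ-nonzero : ∀ i → κ i ≢ 0ℚ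
    κ-nonzero i κ≡0 =
      eval-prodP-≢0 (L j) (snoc1 r) (filterOut⁺ (A d (toℕ i)) (tabulate factor≢0))
        (trans (sym (eval-setLast1 r (Πᵢ i))) κ≡0)
      where
      factor≢0 : ∀ {k} → k ∈ A d (toℕ i) → k ≢ node i → eval (snoc1 r) (L j k) ≢ 0ℚ
      factor≢0 {k} k∈A k≢node eq =
        no-extra-root (snoc1 r) (1≢0 ∘ trans (sym (snoc1-last r)))
          (⟦_⟧ℕ ∘ node) (node-injective ∘ ⟦⟧ℕ-injective) snoc1-roots
          (λ i′ → A-nonnode k∈A k≢node i′ ∘ ⟦⟧ℕ-injective)
          (trans (sym (eval-L (snoc1 r) k)) eq)

    Jac-entry : ∀ i a → Jac d j r i a ≡ κ i * Vand node i a
    Jac-entry i a = begin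
      eval r (∂ a (setLast1 Gᵢ))
        ≡⟨ cong (eval r) (∂-setLast1 a Gᵢ) ⟩
      eval r (setLast1 (∂ (inject₁ a) Gᵢ))
        ≡⟨ eval-setLast1 r (∂ (inject₁ a) Gᵢ) ⟩
      eval (snoc1 r) (∂ (inject₁ a) Gᵢ)
        ≡⟨ eval-∂-prodP-simpleRoot (L j) (snoc1 r) (inject₁ a) (A-unique d (toℕ i)) (node-∈A i) node-root ⟩
      eval (snoc1 r) (∂ (inject₁ a) (L j (node i))) * eval (snoc1 r) (Πᵢ i)
        ≡⟨ cong₂ _*_ (eval-∂-L (snoc1 r) (inject₁ a) (node i)) (sym (eval-setLast1 r (Πᵢ i))) ⟩
      ⟦ node i ℕ.^ toℕ (inject₁ a) ⟧ℕ * κ i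
        ≡⟨ cong (λ x → ⟦ node i ℕ.^ x ⟧ℕ * κ i) (FinP.toℕ-inject₁ a) ⟩
      Vand node i a * κ i
        ≡⟨ ℚP.*-comm (Vand node i a) (κ i) ⟩
      κ i * Vand node i a ∎
      where
      Gᵢ : Poly (suc j)
      Gᵢ = G d (toℕ i) j
      node-root : eval (snoc1 r) (L j (node i)) ≡ 0ℚ
      node-root = trans (eval-L (snoc1 r) (node i)) (snoc1-roots i)

    Jac≐diag·Vand : Jac d j r ≐ diag κ · Vand node
    Jac≐diag·Vand i a = trans (Jac-entry i a) (sym (diag-· κ (Vand node) i a))

open import Data.Nat using (_+_)

lemma5p3 : (n : ℕ) → 1 ≤ n →
    (d : ℕ → ℕ) → (∀ i → i ≤ n → 1 ≤ d i) →
    (j : ℕ) → 1 ≤ j → j ≤ n →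
    (c : Fin j → ℕ) → (∀ i → 1 ≤ c i × c i ≤ d (toℕ i)) →
    -- r_c exists and is unique
    Σ (Fin j → ℚ) (λ r →
        (∀ i → eval r (ℓ j (e d (toℕ i) + c i)) ≡ 0ℚ)
      × (∀ r′ → (∀ i → eval r′ (ℓ j (e d (toℕ i) + c i)) ≡ 0ℚ) → ∀ a → r′ a ≡ r a))
    ×
    -- for r = r_c : J_c invertible and J_c = diag(κ_c) · Vand(e_i + c_i)
    (∀ (r : Fin j → ℚ) → (∀ i → eval r (ℓ j (e d (toℕ i) + c i)) ≡ 0ℚ) →
        Invertible (Jac d j r)
      × (Jac d j r ≐ diag (λ i → eval r (gDiv d (toℕ i) j (e d (toℕ i) + c i)))
                       · Vand (λ i → e d (toℕ i) + c i)))
lemma5p3 _ _ d _ j _ _ c c-bounds =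
  uniqueRoot ,
  λ r roots →
    Invertible-resp-≐ (Jac≐diag·Vand r roots)
      (Invertible-· (diag-invertible (κ-nonzero r roots)) (Vand-invertible node node-injective)) ,
    Jac≐diag·Vand r roots
  where
  open Matrices using (Invertible-resp-≐; Invertible-·; diag-invertible)
  open Vandermonde using (Vand-invertible)
  open Jacobian d c c-bounds
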